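{- Let $S$ be a 1--signature. The category $\mathrm{Rep}^\Delta(S)$ of representations of $S$ in relative monads on $\Delta$ has an initial object. Its underlying monad sends each set $V$ to the set $\Sigma(V)$ of terms of the language specified by $S$ with free variables in $V$, equipped with the diagonal preorder (equality).
   Context: Let $\Delta:\mathbf{Set}\to\mathbf{PO}$ send a set $X$ to the preordered set $(X,=)$. For a functor $F:\mathcal C\to\mathcal D$, a relative monad $P$ on $F$ consists of an object map $P$, morphisms $\eta_c\in\mathcal D(Fc,Pc)$, and maps $\sigma_{c,d}:\mathcal D(Fc,Pd)\to\mathcal D(Pc,Pd)$ with $\sigma(f)\circ\eta_c=f$, $\sigma(\eta_c)=\mathrm{id}$, $\sigma(g)\circ\sigma(f)=\sigma(\sigma(g)\circ f)$. A monad morphism $\tau:P\to Q$ is a family $\tau_c:Pc\to Qc$ with $\tau_d\circ\sigma^P(f)=\sigma^Q(\tau_d\circ f)\circ\tau_c$ and $\tau_c\circ\eta^P_c=\eta^Q_c$. A module $M$ over $P$ with codomain $\mathcal E$ is an object map with maps $\varsigma_{c,d}:\mathcal D(Fc,Pd)\to\mathcal E(Mc,Md)$ satisfying $\varsigma(g)\circ\varsigma(f)=\varsigma(\sigma(g)\circ f)$, $\varsigma(\eta_c)=\mathrm{id}$; module morphisms $\rho$ satisfy $\rho_d\circ\varsigma^M(f)=\varsigma^N(f)\circ\rho_c$. The tautological module $P$ has object map $P$ and substitution $\sigma$; pullback along $h:P\to Q$ keeps the object map and sets $\varsigma^{h^*M}(f)=\varsigma^M(h_d\circ f)$; products are pointwise.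 For a monad $P$ on $\Delta$ and a $P$--module $M$, the derived module $M'$ has $M'(V)=M(V+\{*\})$ and substitution $\varsigma^{M'}(f)=\varsigma^M(\mathrm{shift} f)$, where $\mathrm{shift} f:V+\{*\}\to P(W+\{*\})$ sends $v$ to $P(i)(f(v))$ ($i:W\to W+\{*\}$ the inclusion, $P(i)=\sigma(\eta\circ\Delta i)$) and $*$ to $\eta(*)$. $M^n$ is $M$ derived $n$ times, and $M^s=M^{n_1}\times\dots\times M^{n_m}$ for $s=[n_1,\dots,n_m]$. An arity is a list of natural numbers; a 1--signature $S$ is a family of arities. A representation of $S$ is a monad $R$ on $\Delta$ with, for each $s\in S$, a morphism of $R$--modules (codomain $\mathbf{PO}$) $s^R:R^s\to R$. A morphism of representations $f:P\to Q$ is a monad morphism with $f\circ s^P=f^*(s^Q)\circ f^s$ for all $s\in S$; this gives the category $\mathrm{Rep}^\Delta(S)$. Terms of the language specified by $S$: $\Sigma(V)$ is the inductively defined family of sets (indexed by sets $V$) generated by: each $v\in V$ is a term of $\Sigma(V)$; for each arity $s=[n_1,\dots,n_m]\in S$ and terms $t_j\in\Sigma(V+\{1,\dots,n_j\})$ ($V$ extended by $n_j$ fresh variables), $s(t_1,\dots,t_m)\in\Sigma(V)$. -}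

module Defs where

open import Level using (Level)
open import Data.Nat using (ℕ; zero; suc)
open import Data.Fin using (Fin)
open import Data.List using (List; []; _∷_)
open import Data.List.Relation.Unary.All using (All)
open import Data.Sum using (_⊎_; inj₁; inj₂; [_,_])
open import Data.Unit using (⊤; tt)
open import Data.Product using (Σ; _×_; _,_; proj₁; proj₂)
open import Relation.Binary.PropositionalEquality
  using (_≡_; refl; sym; trans; cong; cong₂)

record PO : Set₁ where
  field
    Carrier : Set
    _≤_     : Carrier → Carrier → Set
    refl≤   : ∀ {x} → x ≤ x
    trans≤  : ∀ {x y z} → x ≤ y → y ≤ z → x ≤ z
open PO public

record _⇒_ (A B : PO) : Set where
  field
    fun  : Carrier A → Carrier B
    mono : ∀ {x y} → _≤_ A x y → _≤_ B (fun x) (fun y)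
open _⇒_ public

infix 4 _≐_
_≐_ : ∀ {A B} → (f g : A ⇒ B) → Set
f ≐ g = ∀ x → fun f x ≡ fun g x

idₘ : ∀ {A} → A ⇒ A
idₘ {A} = record { fun = λ x → x ; mono = λ p → p }

infixr 9 _∘ₘ_
_∘ₘ_ : ∀ {A B C} → B ⇒ C → A ⇒ B → A ⇒ C
g ∘ₘ f = record { fun = λ x → fun g (fun f x) ; mono = λ p → mono g (mono f p) }

Δ : Set → PO
Δ X = record { Carrier = X ; _≤_ = _≡_ ; refl≤ = refl ; trans≤ = trans }

ΔMap : ∀ {X} {A : PO} → (X → Carrier A) → Δ X ⇒ A
ΔMap {A = A} f = record { fun = f ; mono = λ { refl → refl≤ A } }

Δm : ∀ {X Y} → (X → Y) → Δ X ⇒ Δ Y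
Δm f = ΔMap f

record RMonad : Set₁ where
  field
    P     : Set → PO
    η     : ∀ {c} → Δ c ⇒ P c
    σ     : ∀ {c d} → Δ c ⇒ P d → P c ⇒ P d
    -- σ is a map of hom-sets (hom-sets carry extensional equality)
    σ-cong : ∀ {c d} {f g : Δ c ⇒ P d} → f ≐ g → σ f ≐ σ g
    σ-η-r  : ∀ {c d} (f : Δ c ⇒ P d) → σ f ∘ₘ η ≐ f
    σ-η    : ∀ {c} → σ (η {c}) ≐ idₘ
    σ-σ    : ∀ {c d e} (f : Δ c ⇒ P d) (g : Δ d ⇒ P e) →
             σ g ∘ₘ σ f ≐ σ (σ g ∘ₘ f)
open RMonad public

record MonadMor (R T : RMonad) : Set₁ where
  field
    τ   : ∀ c → P R c ⇒ P T c
    τ-σ : ∀ {c d} (f : Δ c ⇒ P R d) →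
          τ d ∘ₘ σ R f ≐ σ T (τ d ∘ₘ f) ∘ₘ τ c
    τ-η : ∀ {c} → τ c ∘ₘ η R ≐ η T
open MonadMor public

record Module (R : RMonad) : Set₁ where
  field
    M      : Set → PO
    ς      : ∀ {c d} → Δ c ⇒ P R d → M c ⇒ M d
    ς-cong : ∀ {c d} {f g : Δ c ⇒ P R d} → f ≐ g → ς f ≐ ς g
    ς-σ    : ∀ {c d e} (f : Δ c ⇒ P R d) (g : Δ d ⇒ P R e) →
             ς g ∘ₘ ς f ≐ ς (σ R g ∘ₘ f)
    ς-η    : ∀ {c} → ς (η R {c}) ≐ idₘ
open Module public

record ModMor {R : RMonad} (A B : Module R) : Set₁ where
  field
    ρ   : ∀ c → M A c ⇒ M B c
    nat : ∀ {c d} (f : Δ c ⇒ P R d) → ρ d ∘ₘ ς A f ≐ ς B f ∘ₘ ρ c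
open ModMor public

taut : (R : RMonad) → Module R
taut R = record
  { M = P R ; ς = σ R ; ς-cong = σ-cong R ; ς-σ = σ-σ R ; ς-η = σ-η R }

module _ (R : RMonad) where

  Pinc : ∀ {W} → P R W ⇒ P R (W ⊎ ⊤)
  Pinc = σ R (η R ∘ₘ Δm inj₁)

  shift : ∀ {V W} → Δ V ⇒ P R W → Δ (V ⊎ ⊤) ⇒ P R (W ⊎ ⊤)
  shift f = ΔMap [ (λ v → fun Pinc (fun f v)) , (λ _ → fun (η R) (inj₂ tt)) ]

  shift-cong : ∀ {V W} {f g : Δ V ⇒ P R W} → f ≐ g → shift f ≐ shift g
  shift-cong e (inj₁ v) = cong (fun Pinc) (e v)
  shift-cong e (inj₂ _) = refl

  shift-η : ∀ {V} → shift (η R {V}) ≐ η R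
  shift-η (inj₁ v) = σ-η-r R (η R ∘ₘ Δm inj₁) v
  shift-η (inj₂ tt) = refl

  shift-σ : ∀ {U V W} (f : Δ U ⇒ P R V) (g : Δ V ⇒ P R W) →
            σ R (shift g) ∘ₘ shift f ≐ shift (σ R g ∘ₘ f)
  shift-σ f g (inj₁ u) =
    trans (σ-σ R (η R ∘ₘ Δm inj₁) (shift g) (fun f u))
      (trans (σ-cong R {f = σ R (shift g) ∘ₘ (η R ∘ₘ Δm inj₁)} {g = Pinc ∘ₘ g}
                (λ w → σ-η-r R (shift g) (inj₁ w)) (fun f u))
             (sym (σ-σ R g (η R ∘ₘ Δm inj₁) (fun f u))))
  shift-σ f g (inj₂ tt) = σ-η-r R (shift g) (inj₂ tt)

  derived : Module R → Module R
  derived A = record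
    { M = λ V → M A (V ⊎ ⊤)
    ; ς = λ f → ς A (shift f)
    ; ς-cong = λ {c} {d} {f} {g} e → ς-cong A {f = shift f} {g = shift g} (shift-cong {f = f} {g = g} e)
    ; ς-σ = λ f g x → trans (ς-σ A (shift f) (shift g) x)
                            (ς-cong A (shift-σ f g) x)
    ; ς-η = λ x → trans (ς-cong A shift-η x) (ς-η A x)
    }

  deriv : ℕ → Module R → Module R
  deriv zero A = A
  deriv (suc n) A = derived (deriv n A)

  _×ₚ_ : PO → PO → PO
  A ×ₚ B = record
    { Carrier = Carrier A × Carrier B
    ; _≤_ = λ x y → _≤_ A (proj₁ x) (proj₁ y) × _≤_ B (proj₂ x) (proj₂ y)
    ; refl≤ = refl≤ A , refl≤ B
    ; trans≤ = λ p q → trans≤ A (proj₁ p) (proj₁ q) , trans≤ B (proj₂ p) (proj₂ q)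
    }

  𝟙ₚ : PO
  𝟙ₚ = record { Carrier = ⊤ ; _≤_ = λ _ _ → ⊤ ; refl≤ = tt ; trans≤ = λ _ _ → tt }

  _×ₘ_ : Module R → Module R → Module R
  A ×ₘ B = record
    { M = λ V → M A V ×ₚ M B V
    ; ς = λ f → record
        { fun = λ x → fun (ς A f) (proj₁ x) , fun (ς B f) (proj₂ x)
        ; mono = λ p → mono (ς A f) (proj₁ p) , mono (ς B f) (proj₂ p) }
    ; ς-cong = λ e x → cong₂ _,_ (ς-cong A e (proj₁ x)) (ς-cong B e (proj₂ x))
    ; ς-σ = λ f g x → cong₂ _,_ (ς-σ A f g (proj₁ x)) (ς-σ B f g (proj₂ x))
    ; ς-η = λ x → cong₂ _,_ (ς-η A (proj₁ x)) (ς-η B (proj₂ x))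
    }

  𝟙ₘ : Module R
  𝟙ₘ = record
    { M = λ _ → 𝟙ₚ
    ; ς = λ _ → record { fun = λ _ → tt ; mono = λ _ → tt }
    ; ς-cong = λ _ _ → refl ; ς-σ = λ _ _ _ → refl ; ς-η = λ _ → refl }

  arMod : List ℕ → Module R → Module R
  arMod [] A = 𝟙ₘ
  arMod (n ∷ []) A = deriv n A
  arMod (n ∷ m ∷ s) A = deriv n A ×ₘ arMod (m ∷ s) A

record Sig : Set₁ where
  field
    Op : Set
    ar : Op → List ℕ
open Sig public

record Rep (S : Sig) : Set₁ where
  field
    monad : RMonad
    op    : (o : Op S) → ModMor (arMod monad (ar S o) (taut monad)) (taut monad)
open Rep public

liftD : ∀ {R T} (f : MonadMor R T) (n : ℕ) (V : Set) →
        M (deriv R n (taut R)) V ⇒ M (deriv T n (taut T)) V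
liftD f zero V = τ f V
liftD f (suc n) V = liftD f n (V ⊎ ⊤)

liftA : ∀ {R T} (f : MonadMor R T) (s : List ℕ) (V : Set) →
        M (arMod R s (taut R)) V ⇒ M (arMod T s (taut T)) V
liftA f [] V = record { fun = λ _ → tt ; mono = λ _ → tt }
liftA f (n ∷ []) V = liftD f n V
liftA f (n ∷ m ∷ s) V = record
  { fun = λ x → fun (liftD f n V) (proj₁ x) , fun (liftA f (m ∷ s) V) (proj₂ x)
  ; mono = λ p → mono (liftD f n V) (proj₁ p) , mono (liftA f (m ∷ s) V) (proj₂ p) }

record RepMor {S : Sig} (A B : Rep S) : Set₁ where
  field
    mor    : MonadMor (monad A) (monad B)
    commut : ∀ (o : Op S) (V : Set) →
             τ mor V ∘ₘ ρ (op A o) V ≐ ρ (op B o) V ∘ₘ liftA mor (ar S o) V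
open RepMor public

_≐ᵣ_ : ∀ {S} {A B : Rep S} → RepMor A B → RepMor A B → Set₁
f ≐ᵣ g = ∀ (V : Set) → τ (mor f) V ≐ τ (mor g) V

IsInitial : ∀ {S} → Rep S → Set₁
IsInitial {S} A = ∀ (B : Rep S) → Σ (RepMor A B) (λ f → ∀ (g : RepMor A B) → f ≐ᵣ g)

data Term (S : Sig) (V : Set) : Set where
  var : V → Term S V
  app : (o : Op S) → All (λ n → Term S (V ⊎ Fin n)) (ar S o) → Term S V

module Submission where

-- Terms with simultaneous substitution form a relative monad on Δ, and app o is a module
-- morphism once the block V ⊎ Fin n of each argument is read as the n-fold derived context.
-- For a representation B over R, the morphism out of terms is the fold sending var to η and
-- app o to B's module morphism for o. It commutes with substitution because every fold
-- factors as fold e t = σ e (fold η t), which at app o is exactly the naturality of B's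
-- module morphism. A morphism of representations preserves η and commutes with every app o,
-- so by induction on terms it coincides with the fold.

open import Data.Fin using (Fin; zero; suc)
open import Data.List using (List; []; _∷_)
open import Data.List.Relation.Unary.All using (All; []; _∷_)
open import Data.Nat using (ℕ; zero; suc)
open import Data.Product using (Σ; _×_; _,_)
open import Data.Sum using (_⊎_; inj₁; inj₂; [_,_]; map₁)
open import Data.Unit using (⊤; tt)
open import Function using (_∘_; id)
open import Relation.Binary.PropositionalEquality
  using (_≡_; _≗_; refl; sym; trans; cong; cong₂; module ≡-Reasoning)

open import Defs

private variable
  U V W X Y : Set
  n : ℕ
  s : List ℕ

-- Derived modules bind fresh variables one at a time (V ↦ V ⊎ ⊤), whereas Term binds a
-- block V ⊎ Fin n; toSum and fromSum translate between the two.
Ext : ℕ → Set → Set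
Ext zero V = V
Ext (suc n) V = Ext n (V ⊎ ⊤)

weaken : ∀ n → V → Ext n V
weaken zero v = v
weaken (suc n) v = weaken n (inj₁ v)

fresh : ∀ n → Fin n → Ext n V
fresh (suc n) zero = weaken n (inj₂ tt)
fresh {V} (suc n) (suc i) = fresh {V ⊎ ⊤} n i

fromSum : ∀ n → V ⊎ Fin n → Ext n V
fromSum n = [ weaken n , fresh n ]

reassoc : (V ⊎ ⊤) ⊎ Fin n → V ⊎ Fin (suc n)
reassoc (inj₁ (inj₁ v)) = inj₁ v
reassoc (inj₁ (inj₂ tt)) = inj₂ zero
reassoc (inj₂ i) = inj₂ (suc i)

toSum : ∀ n → Ext n V → V ⊎ Fin n
toSum zero x = inj₁ x
toSum (suc n) x = reassoc (toSum n x)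

toSum-weaken : ∀ n (v : V) → toSum n (weaken n v) ≡ inj₁ v
toSum-weaken zero v = refl
toSum-weaken (suc n) v = cong reassoc (toSum-weaken n (inj₁ v))

toSum-fresh : ∀ n (i : Fin n) → toSum n (fresh {V} n i) ≡ inj₂ i
toSum-fresh (suc n) zero = cong reassoc (toSum-weaken n (inj₂ tt))
toSum-fresh {V} (suc n) (suc i) = cong reassoc (toSum-fresh {V ⊎ ⊤} n i)

toSum-fromSum : ∀ n (y : V ⊎ Fin n) → toSum n (fromSum n y) ≡ y
toSum-fromSum n (inj₁ v) = toSum-weaken n v
toSum-fromSum n (inj₂ i) = toSum-fresh n i

fromSum-reassoc : ∀ n (y : (V ⊎ ⊤) ⊎ Fin n) → fromSum (suc n) (reassoc y) ≡ fromSum n y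
fromSum-reassoc n (inj₁ (inj₁ v)) = refl
fromSum-reassoc n (inj₁ (inj₂ tt)) = refl
fromSum-reassoc n (inj₂ i) = refl

fromSum-toSum : ∀ n (x : Ext n V) → fromSum n (toSum n x) ≡ x
fromSum-toSum zero x = refl
fromSum-toSum (suc n) x = trans (fromSum-reassoc n (toSum n x)) (fromSum-toSum n x)

module Extension (R : RMonad) where

  shiftⁿ : ∀ n → Δ V ⇒ P R W → Δ (Ext n V) ⇒ P R (Ext n W)
  shiftⁿ zero f = f
  shiftⁿ (suc n) f = shiftⁿ n (shift R f)

  weakenᴾ : ∀ n → P R W ⇒ P R (Ext n W)
  weakenᴾ zero = idₘ
  weakenᴾ (suc n) = weakenᴾ n ∘ₘ Pinc R

  shiftⁿ-weaken : ∀ n (f : Δ V ⇒ P R W) x →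
                  fun (shiftⁿ n f) (weaken n x) ≡ fun (weakenᴾ n) (fun f x)
  shiftⁿ-weaken zero f x = refl
  shiftⁿ-weaken (suc n) f x = shiftⁿ-weaken n (shift R f) (inj₁ x)

  weakenᴾ-η : ∀ n (x : W) → fun (weakenᴾ n) (fun (η R) x) ≡ fun (η R) (weaken n x)
  weakenᴾ-η zero x = refl
  weakenᴾ-η (suc n) x =
    trans (cong (fun (weakenᴾ n)) (σ-η-r R (η R ∘ₘ Δm inj₁) x)) (weakenᴾ-η n (inj₁ x))

  shiftⁿ-fresh : ∀ n (f : Δ V ⇒ P R W) i →
                 fun (shiftⁿ n f) (fresh n i) ≡ fun (η R) (fresh n i)
  shiftⁿ-fresh (suc n) f zero =
    trans (shiftⁿ-weaken n (shift R f) (inj₂ tt)) (weakenᴾ-η n (inj₂ tt))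
  shiftⁿ-fresh (suc n) f (suc i) = shiftⁿ-fresh n (shift R f) i

  weakenᴾ≐σ : ∀ n {W} → weakenᴾ n ≐ σ R (η R ∘ₘ Δm (weaken {W} n))
  weakenᴾ≐σ zero p = sym (trans (σ-cong R {f = η R ∘ₘ Δm id} {g = η R} (λ _ → refl) p) (σ-η R p))
  weakenᴾ≐σ (suc n) p = begin
    fun (weakenᴾ n) (fun (Pinc R) p)
      ≡⟨ weakenᴾ≐σ n _ ⟩
    fun (σ R (η R ∘ₘ Δm (weaken n))) (fun (σ R (η R ∘ₘ Δm inj₁)) p)
      ≡⟨ σ-σ R (η R ∘ₘ Δm inj₁) (η R ∘ₘ Δm (weaken n)) p ⟩
    fun (σ R (σ R (η R ∘ₘ Δm (weaken n)) ∘ₘ (η R ∘ₘ Δm inj₁))) p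
      ≡⟨ σ-cong R {g = η R ∘ₘ Δm (weaken (suc n))}
                  (λ x → σ-η-r R (η R ∘ₘ Δm (weaken n)) (inj₁ x)) p ⟩
    fun (σ R (η R ∘ₘ Δm (weaken (suc n)))) p ∎
    where open ≡-Reasoning

  -- M (deriv R n (taut R)) V unfolds to P R (Ext n V) only after case analysis on n.
  toDeriv : ∀ n → Carrier (M (deriv R n (taut R)) V) → Carrier (P R (Ext n V))
  toDeriv zero x = x
  toDeriv (suc n) x = toDeriv n x

  fromDeriv : ∀ n → Carrier (P R (Ext n V)) → Carrier (M (deriv R n (taut R)) V)
  fromDeriv zero x = x
  fromDeriv (suc n) x = fromDeriv n x

  toDeriv-fromDeriv : ∀ n (p : Carrier (P R (Ext n V))) → toDeriv n (fromDeriv n p) ≡ p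
  toDeriv-fromDeriv zero p = refl
  toDeriv-fromDeriv (suc n) p = toDeriv-fromDeriv n p

  ς-fromDeriv : ∀ n (f : Δ V ⇒ P R W) p →
                fun (ς (deriv R n (taut R)) f) (fromDeriv n p) ≡ fromDeriv n (fun (σ R (shiftⁿ n f)) p)
  ς-fromDeriv zero f p = refl
  ς-fromDeriv (suc n) f p = ς-fromDeriv n (shift R f) p

  toDeriv-ς : ∀ n (f : Δ V ⇒ P R W) x →
              toDeriv n (fun (ς (deriv R n (taut R)) f) x) ≡ fun (σ R (shiftⁿ n f)) (toDeriv n x)
  toDeriv-ς zero f x = refl
  toDeriv-ς (suc n) f x = toDeriv-ς n (shift R f) x

liftD-toDeriv : ∀ {R T} (f : MonadMor R T) n {V} x →
                fun (liftD f n V) x ≡ Extension.fromDeriv T n (fun (τ f (Ext n V)) (Extension.toDeriv R n x))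
liftD-toDeriv f zero x = refl
liftD-toDeriv f (suc n) x = liftD-toDeriv f n x

τ-Pinc : ∀ {R T} (f : MonadMor R T) {W} p →
         fun (τ f (W ⊎ ⊤)) (fun (Pinc R) p) ≡ fun (Pinc T) (fun (τ f W) p)
τ-Pinc {R} {T} f {W} p =
  trans (τ-σ f (η R ∘ₘ Δm inj₁) p)
        (σ-cong T {f = τ f (W ⊎ ⊤) ∘ₘ (η R ∘ₘ Δm inj₁)} {g = η T ∘ₘ Δm inj₁}
                (λ x → τ-η f (inj₁ x)) (fun (τ f W) p))

τ-weakenᴾ : ∀ {R T} (f : MonadMor R T) n {W} p →
            fun (τ f (Ext n W)) (fun (Extension.weakenᴾ R n) p) ≡ fun (Extension.weakenᴾ T n) (fun (τ f W) p)
τ-weakenᴾ f zero p = refl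
τ-weakenᴾ {R} {T} f (suc n) p =
  trans (τ-weakenᴾ f n (fun (Pinc R) p)) (cong (fun (Extension.weakenᴾ T n)) (τ-Pinc f p))

module Syntax (S : Sig) where

  Args : Set → List ℕ → Set
  Args V = All (λ n → Term S (V ⊎ Fin n))

  mutual
    ren : (V → W) → Term S V → Term S W
    ren r (var v) = var (r v)
    ren r (app o ts) = app o (renArgs r ts)

    renArgs : (V → W) → Args V s → Args W s
    renArgs r [] = []
    renArgs r (t ∷ ts) = ren (map₁ r) t ∷ renArgs r ts

  exts : (V → Term S W) → V ⊎ Fin n → Term S (W ⊎ Fin n)
  exts f (inj₁ v) = ren inj₁ (f v)
  exts f (inj₂ i) = var (inj₂ i)

  mutual
    sub : (V → Term S W) → Term S V → Term S W
    sub f (var v) = f v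
    sub f (app o ts) = app o (subArgs f ts)

    subArgs : (V → Term S W) → Args V s → Args W s
    subArgs f [] = []
    subArgs f (t ∷ ts) = sub (exts f) t ∷ subArgs f ts

  mutual
    ren-ren : {r : U → V} {r′ : V → W} {q : U → W} → r′ ∘ r ≗ q → ren r′ ∘ ren r ≗ ren q
    ren-ren e (var v) = cong var (e v)
    ren-ren e (app o ts) = cong (app o) (renArgs-renArgs e ts)

    renArgs-renArgs : {r : U → V} {r′ : V → W} {q : U → W} → r′ ∘ r ≗ q →
                      renArgs {s = s} r′ ∘ renArgs r ≗ renArgs q
    renArgs-renArgs e [] = refl
    renArgs-renArgs e (t ∷ ts) =
      cong₂ _∷_ (ren-ren (λ { (inj₁ v) → cong inj₁ (e v) ; (inj₂ i) → refl }) t)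
                (renArgs-renArgs e ts)

  mutual
    ren-id : {r : V → V} → r ≗ id → ren r ≗ id
    ren-id e (var v) = cong var (e v)
    ren-id e (app o ts) = cong (app o) (renArgs-id e ts)

    renArgs-id : {r : V → V} → r ≗ id → renArgs {s = s} r ≗ id
    renArgs-id e [] = refl
    renArgs-id e (t ∷ ts) =
      cong₂ _∷_ (ren-id (λ { (inj₁ v) → cong inj₁ (e v) ; (inj₂ i) → refl }) t)
                (renArgs-id e ts)

  mutual
    sub-cong : {f g : V → Term S W} → f ≗ g → sub f ≗ sub g
    sub-cong e (var v) = e v
    sub-cong e (app o ts) = cong (app o) (subArgs-cong e ts)

    subArgs-cong : {f g : V → Term S W} → f ≗ g → subArgs {s = s} f ≗ subArgs g
    subArgs-cong e [] = refl
    subArgs-cong e (t ∷ ts) =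
      cong₂ _∷_ (sub-cong (λ { (inj₁ v) → cong (ren inj₁) (e v) ; (inj₂ i) → refl }) t)
                (subArgs-cong e ts)

  mutual
    sub-var : {f : V → Term S V} → f ≗ var → sub f ≗ id
    sub-var e (var v) = e v
    sub-var e (app o ts) = cong (app o) (subArgs-var e ts)

    subArgs-var : {f : V → Term S V} → f ≗ var → subArgs {s = s} f ≗ id
    subArgs-var e [] = refl
    subArgs-var e (t ∷ ts) =
      cong₂ _∷_ (sub-var (λ { (inj₁ v) → cong (ren inj₁) (e v) ; (inj₂ i) → refl }) t)
                (subArgs-var e ts)

  mutual
    sub-ren : {r : U → V} {f : V → Term S W} {g : U → Term S W} → f ∘ r ≗ g → sub f ∘ ren r ≗ sub g
    sub-ren e (var v) = e v
    sub-ren e (app o ts) = cong (app o) (subArgs-renArgs e ts)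

    subArgs-renArgs : {r : U → V} {f : V → Term S W} {g : U → Term S W} → f ∘ r ≗ g →
                      subArgs {s = s} f ∘ renArgs r ≗ subArgs g
    subArgs-renArgs e [] = refl
    subArgs-renArgs e (t ∷ ts) =
      cong₂ _∷_ (sub-ren (λ { (inj₁ v) → cong (ren inj₁) (e v) ; (inj₂ i) → refl }) t)
                (subArgs-renArgs e ts)

  mutual
    sub≗ren : {r : V → W} {f : V → Term S W} → f ≗ var ∘ r → sub f ≗ ren r
    sub≗ren e (var v) = e v
    sub≗ren e (app o ts) = cong (app o) (subArgs≗renArgs e ts)

    subArgs≗renArgs : {r : V → W} {f : V → Term S W} → f ≗ var ∘ r → subArgs {s = s} f ≗ renArgs r
    subArgs≗renArgs e [] = refl
    subArgs≗renArgs e (t ∷ ts) =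
      cong₂ _∷_ (sub≗ren (λ { (inj₁ v) → cong (ren inj₁) (e v) ; (inj₂ i) → refl }) t)
                (subArgs≗renArgs e ts)

  ren-exts : {r : W → X} {f : V → Term S W} {g : V → Term S X} → ren r ∘ f ≗ g →
             ren (map₁ r) ∘ exts {n = n} f ≗ exts g
  ren-exts {f = f} e (inj₁ v) =
    trans (ren-ren (λ _ → refl) (f v)) (trans (sym (ren-ren (λ _ → refl) (f v))) (cong (ren inj₁) (e v)))
  ren-exts e (inj₂ i) = refl

  mutual
    ren-sub : {r : W → X} {f : V → Term S W} {g : V → Term S X} →
              ren r ∘ f ≗ g → ren r ∘ sub f ≗ sub g
    ren-sub e (var v) = e v
    ren-sub e (app o ts) = cong (app o) (renArgs-subArgs e ts)

    renArgs-subArgs : {r : W → X} {f : V → Term S W} {g : V → Term S X} → ren r ∘ f ≗ g →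
                      renArgs {s = s} r ∘ subArgs f ≗ subArgs g
    renArgs-subArgs e [] = refl
    renArgs-subArgs e (t ∷ ts) = cong₂ _∷_ (ren-sub (ren-exts e) t) (renArgs-subArgs e ts)

  sub-exts : {f : U → Term S V} {g : V → Term S W} {h : U → Term S W} → sub g ∘ f ≗ h →
             sub (exts g) ∘ exts {n = n} f ≗ exts h
  sub-exts {f = f} e (inj₁ v) =
    trans (sub-ren (λ _ → refl) (f v)) (trans (sym (ren-sub (λ _ → refl) (f v))) (cong (ren inj₁) (e v)))
  sub-exts e (inj₂ i) = refl

  mutual
    sub-sub : {f : U → Term S V} {g : V → Term S W} {h : U → Term S W} →
              sub g ∘ f ≗ h → sub g ∘ sub f ≗ sub h
    sub-sub e (var v) = e v
    sub-sub e (app o ts) = cong (app o) (subArgs-subArgs e ts)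

    subArgs-subArgs : {f : U → Term S V} {g : V → Term S W} {h : U → Term S W} → sub g ∘ f ≗ h →
                      subArgs {s = s} g ∘ subArgs f ≗ subArgs h
    subArgs-subArgs e [] = refl
    subArgs-subArgs e (t ∷ ts) = cong₂ _∷_ (sub-sub (sub-exts e) t) (subArgs-subArgs e ts)

  termMonad : RMonad
  termMonad = record
    { P = λ V → Δ (Term S V)
    ; η = ΔMap var
    ; σ = λ f → ΔMap (sub (fun f))
    ; σ-cong = sub-cong
    ; σ-η-r = λ f x → refl
    ; σ-η = sub-var (λ _ → refl)
    ; σ-σ = λ f g → sub-sub (λ _ → refl)
    }

  open Extension termMonad
    using ( weakenᴾ; weakenᴾ≐σ; shiftⁿ; shiftⁿ-weaken; shiftⁿ-fresh
          ; toDeriv; fromDeriv; toDeriv-fromDeriv; toDeriv-ς )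

  weakenᴾ≐ren : ∀ n (t : Term S W) → fun (weakenᴾ n) t ≡ ren (weaken n) t
  weakenᴾ≐ren n t = trans (weakenᴾ≐σ n t) (sub≗ren (λ _ → refl) t)

  argsOf : ∀ s → Carrier (M (arMod termMonad s (taut termMonad)) V) → Args V s
  argsOf [] _ = []
  argsOf (n ∷ []) x = ren (toSum n) (toDeriv n x) ∷ []
  argsOf (n ∷ m ∷ s) (x , y) = ren (toSum n) (toDeriv n x) ∷ argsOf (m ∷ s) y

  argsTuple : ∀ s → Args V s → Carrier (M (arMod termMonad s (taut termMonad)) V)
  argsTuple [] _ = tt
  argsTuple (n ∷ []) (t ∷ []) = fromDeriv n (ren (fromSum n) t)
  argsTuple (n ∷ m ∷ s) (t ∷ ts) = fromDeriv n (ren (fromSum n) t) , argsTuple (m ∷ s) ts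

  ren-toSum-fromDeriv : ∀ n (t : Term S (V ⊎ Fin n)) →
                        ren (toSum n) (toDeriv n (fromDeriv n (ren (fromSum n) t))) ≡ t
  ren-toSum-fromDeriv n t =
    trans (cong (ren (toSum n)) (toDeriv-fromDeriv n (ren (fromSum n) t)))
          (trans (ren-ren (toSum-fromSum n) t) (ren-id (λ _ → refl) t))

  argsOf-argsTuple : ∀ s (ts : Args V s) → argsOf s (argsTuple s ts) ≡ ts
  argsOf-argsTuple [] [] = refl
  argsOf-argsTuple (n ∷ []) (t ∷ []) = cong (_∷ []) (ren-toSum-fromDeriv n t)
  argsOf-argsTuple (n ∷ m ∷ s) (t ∷ ts) =
    cong₂ _∷_ (ren-toSum-fromDeriv n t) (argsOf-argsTuple (m ∷ s) ts)

  toDeriv-mono : ∀ n {x y} → _≤_ (M (deriv termMonad n (taut termMonad)) V) x y →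
                 toDeriv n x ≡ toDeriv n y
  toDeriv-mono zero p = p
  toDeriv-mono (suc n) p = toDeriv-mono n p

  argsOf-mono : ∀ s {x y} → _≤_ (M (arMod termMonad s (taut termMonad)) V) x y →
                argsOf s x ≡ argsOf s y
  argsOf-mono [] p = refl
  argsOf-mono (n ∷ []) p = cong (λ z → ren (toSum n) z ∷ []) (toDeriv-mono n p)
  argsOf-mono (n ∷ m ∷ s) (p , q) =
    cong₂ _∷_ (cong (ren (toSum n)) (toDeriv-mono n p)) (argsOf-mono (m ∷ s) q)

  toSum-shiftⁿ : ∀ n (f : Δ V ⇒ Δ (Term S W)) →
                 ren (toSum n) ∘ fun (shiftⁿ n f) ≗ exts (fun f) ∘ toSum n
  toSum-shiftⁿ n f z =
    trans (cong (ren (toSum n) ∘ fun (shiftⁿ n f)) (sym (fromSum-toSum n z))) (onSum (toSum n z))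
    where
    onSum : ∀ y → ren (toSum n) (fun (shiftⁿ n f) (fromSum n y)) ≡ exts (fun f) y
    onSum (inj₁ v) = begin
      ren (toSum n) (fun (shiftⁿ n f) (weaken n v)) ≡⟨ cong (ren (toSum n)) (shiftⁿ-weaken n f v) ⟩
      ren (toSum n) (fun (weakenᴾ n) (fun f v))     ≡⟨ cong (ren (toSum n)) (weakenᴾ≐ren n (fun f v)) ⟩
      ren (toSum n) (ren (weaken n) (fun f v))      ≡⟨ ren-ren (toSum-weaken n) (fun f v) ⟩
      ren inj₁ (fun f v)                            ∎
      where open ≡-Reasoning
    onSum (inj₂ i) = trans (cong (ren (toSum n)) (shiftⁿ-fresh n f i)) (cong var (toSum-fresh n i))

  toSum-ς-deriv : ∀ n (f : Δ V ⇒ Δ (Term S W)) x →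
                  ren (toSum n) (toDeriv n (fun (ς (deriv termMonad n (taut termMonad)) f) x))
                  ≡ sub (exts (fun f)) (ren (toSum n) (toDeriv n x))
  toSum-ς-deriv n f x = begin
    ren (toSum n) (toDeriv n (fun (ς (deriv termMonad n (taut termMonad)) f) x))
      ≡⟨ cong (ren (toSum n)) (toDeriv-ς n f x) ⟩
    ren (toSum n) (sub (fun (shiftⁿ n f)) (toDeriv n x))
      ≡⟨ ren-sub (λ _ → refl) (toDeriv n x) ⟩
    sub (ren (toSum n) ∘ fun (shiftⁿ n f)) (toDeriv n x)
      ≡⟨ sub-cong (toSum-shiftⁿ n f) (toDeriv n x) ⟩
    sub (exts (fun f) ∘ toSum n) (toDeriv n x)
      ≡⟨ sub-ren (λ _ → refl) (toDeriv n x) ⟨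
    sub (exts (fun f)) (ren (toSum n) (toDeriv n x)) ∎
    where open ≡-Reasoning

  argsOf-ς : ∀ s (f : Δ V ⇒ Δ (Term S W)) x →
             argsOf s (fun (ς (arMod termMonad s (taut termMonad)) f) x) ≡ subArgs (fun f) (argsOf s x)
  argsOf-ς [] f x = refl
  argsOf-ς (n ∷ []) f x = cong (_∷ []) (toSum-ς-deriv n f x)
  argsOf-ς (n ∷ m ∷ s) f (x , y) = cong₂ _∷_ (toSum-ς-deriv n f x) (argsOf-ς (m ∷ s) f y)

  termRep : Rep S
  termRep = record { monad = termMonad ; op = termOp }
    where
    termOp : (o : Op S) → ModMor (arMod termMonad (ar S o) (taut termMonad)) (taut termMonad)
    termOp o = record
      { ρ = λ V → record { fun = app o ∘ argsOf (ar S o) ; mono = cong (app o) ∘ argsOf-mono (ar S o) }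
      ; nat = λ f x → cong (app o) (argsOf-ς (ar S o) f x)
      }

  module Fold (B : Rep S) where

    private
      R = monad B
      module ER = Extension R

    ηᴮ : X → Carrier (P R X)
    ηᴮ = fun (η R)

    extend : ∀ n → (X → Carrier (P R Y)) → X ⊎ Fin n → Carrier (P R (Ext n Y))
    extend n e (inj₁ x) = fun (ER.weakenᴾ n) (e x)
    extend n e (inj₂ i) = ηᴮ (fresh n i)

    mutual
      fold : (X → Carrier (P R Y)) → Term S X → Carrier (P R Y)
      fold e (var x) = e x
      fold {Y = Y} e (app o ts) = fun (ρ (op B o) Y) (foldArgs e (ar S o) ts)

      foldArgs : (X → Carrier (P R Y)) → ∀ s → Args X s → Carrier (M (arMod R s (taut R)) Y)
      foldArgs e [] [] = tt
      foldArgs e (n ∷ []) (t ∷ []) = ER.fromDeriv n (fold (extend n e) t)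
      foldArgs e (n ∷ m ∷ s) (t ∷ ts) = ER.fromDeriv n (fold (extend n e) t) , foldArgs e (m ∷ s) ts

    extend-cong : ∀ n {e e′ : X → Carrier (P R Y)} → e ≗ e′ → extend n e ≗ extend n e′
    extend-cong n p (inj₁ x) = cong (fun (ER.weakenᴾ n)) (p x)
    extend-cong n p (inj₂ i) = refl

    mutual
      fold-cong : {e e′ : X → Carrier (P R Y)} → e ≗ e′ → fold e ≗ fold e′
      fold-cong p (var x) = p x
      fold-cong {Y = Y} p (app o ts) = cong (fun (ρ (op B o) Y)) (foldArgs-cong p (ar S o) ts)

      foldArgs-cong : {e e′ : X → Carrier (P R Y)} → e ≗ e′ → ∀ s → foldArgs e s ≗ foldArgs e′ s
      foldArgs-cong p [] [] = refl
      foldArgs-cong p (n ∷ []) (t ∷ []) = cong (ER.fromDeriv n) (fold-cong (extend-cong n p) t)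
      foldArgs-cong p (n ∷ m ∷ s) (t ∷ ts) =
        cong₂ _,_ (cong (ER.fromDeriv n) (fold-cong (extend-cong n p) t)) (foldArgs-cong p (m ∷ s) ts)

    σ-shiftⁿ-extend : ∀ n (e : X → Carrier (P R Y)) →
                      fun (σ R (ER.shiftⁿ n (ΔMap e))) ∘ extend n ηᴮ ≗ extend n e
    σ-shiftⁿ-extend n e (inj₁ x) = begin
      fun (σ R sh) (fun (ER.weakenᴾ n) (ηᴮ x)) ≡⟨ cong (fun (σ R sh)) (ER.weakenᴾ-η n x) ⟩
      fun (σ R sh) (ηᴮ (weaken n x))            ≡⟨ σ-η-r R sh (weaken n x) ⟩
      fun sh (weaken n x)                       ≡⟨ ER.shiftⁿ-weaken n (ΔMap e) x ⟩
      fun (ER.weakenᴾ n) (e x)                  ∎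
      where open ≡-Reasoning
            sh = ER.shiftⁿ n (ΔMap e)
    σ-shiftⁿ-extend n e (inj₂ i) =
      trans (σ-η-r R (ER.shiftⁿ n (ΔMap e)) (fresh n i)) (ER.shiftⁿ-fresh n (ΔMap e) i)

    mutual
      fold-σ : ∀ (e : X → Carrier (P R Y)) t → fold e t ≡ fun (σ R (ΔMap e)) (fold ηᴮ t)
      fold-σ e (var x) = sym (σ-η-r R (ΔMap e) x)
      fold-σ {Y = Y} e (app o ts) =
        trans (cong (fun (ρ (op B o) Y)) (foldArgs-ς e (ar S o) ts))
              (nat (op B o) (ΔMap e) (foldArgs ηᴮ (ar S o) ts))

      foldArgs-ς : ∀ (e : X → Carrier (P R Y)) s ts →
                   foldArgs e s ts ≡ fun (ς (arMod R s (taut R)) (ΔMap e)) (foldArgs ηᴮ s ts)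
      foldArgs-ς e [] [] = refl
      foldArgs-ς e (n ∷ []) (t ∷ []) = fromDeriv-fold-σ n e t
      foldArgs-ς e (n ∷ m ∷ s) (t ∷ ts) = cong₂ _,_ (fromDeriv-fold-σ n e t) (foldArgs-ς e (m ∷ s) ts)

      fromDeriv-fold-σ : ∀ n (e : X → Carrier (P R Y)) t →
                         ER.fromDeriv n (fold (extend n e) t)
                         ≡ fun (ς (deriv R n (taut R)) (ΔMap e)) (ER.fromDeriv n (fold (extend n ηᴮ) t))
      fromDeriv-fold-σ n e t =
        trans (cong (ER.fromDeriv n) (fold-extend-σ n e t)) (sym (ER.ς-fromDeriv n (ΔMap e) _))

      fold-extend-σ : ∀ n (e : X → Carrier (P R Y)) t →
                      fold (extend n e) t ≡ fun (σ R (ER.shiftⁿ n (ΔMap e))) (fold (extend n ηᴮ) t)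
      fold-extend-σ n e t = begin
        fold (extend n e) t
          ≡⟨ fold-σ (extend n e) t ⟩
        fun (σ R (ΔMap (extend n e))) (fold ηᴮ t)
          ≡⟨ σ-cong R {g = σ R sh ∘ₘ ΔMap (extend n ηᴮ)} (sym ∘ σ-shiftⁿ-extend n e) (fold ηᴮ t) ⟩
        fun (σ R (σ R sh ∘ₘ ΔMap (extend n ηᴮ))) (fold ηᴮ t)
          ≡⟨ σ-σ R (ΔMap (extend n ηᴮ)) sh (fold ηᴮ t) ⟨
        fun (σ R sh) (fun (σ R (ΔMap (extend n ηᴮ))) (fold ηᴮ t))
          ≡⟨ cong (fun (σ R sh)) (fold-σ (extend n ηᴮ) t) ⟨
        fun (σ R sh) (fold (extend n ηᴮ) t) ∎
        where open ≡-Reasoning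
              sh = ER.shiftⁿ n (ΔMap e)

    mutual
      fold-ren : ∀ (e : W → Carrier (P R Y)) (r : X → W) → fold e ∘ ren r ≗ fold (e ∘ r)
      fold-ren e r (var x) = refl
      fold-ren {Y = Y} e r (app o ts) = cong (fun (ρ (op B o) Y)) (foldArgs-renArgs e r (ar S o) ts)

      foldArgs-renArgs : ∀ (e : W → Carrier (P R Y)) (r : X → W) s →
                         foldArgs e s ∘ renArgs r ≗ foldArgs (e ∘ r) s
      foldArgs-renArgs e r [] [] = refl
      foldArgs-renArgs e r (n ∷ []) (t ∷ []) = cong (ER.fromDeriv n) (fold-extend-ren n e r t)
      foldArgs-renArgs e r (n ∷ m ∷ s) (t ∷ ts) =
        cong₂ _,_ (cong (ER.fromDeriv n) (fold-extend-ren n e r t)) (foldArgs-renArgs e r (m ∷ s) ts)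

      fold-extend-ren : ∀ n (e : W → Carrier (P R Y)) (r : X → W) →
                        fold (extend n e) ∘ ren (map₁ r) ≗ fold (extend n (e ∘ r))
      fold-extend-ren n e r t =
        trans (fold-ren (extend n e) (map₁ r) t) (fold-cong (λ { (inj₁ x) → refl ; (inj₂ i) → refl }) t)

    fold-weakenᴾ : ∀ n (e : X → Carrier (P R Y)) →
                   fold (fun (ER.weakenᴾ n) ∘ e) ≗ fun (ER.weakenᴾ n) ∘ fold e
    fold-weakenᴾ n e u = begin
      fold (fun (ER.weakenᴾ n) ∘ e) u
        ≡⟨ fold-σ (fun (ER.weakenᴾ n) ∘ e) u ⟩
      fun (σ R (ΔMap (fun (ER.weakenᴾ n) ∘ e))) (fold ηᴮ u)
        ≡⟨ σ-cong R {g = σ R ηweaken ∘ₘ ΔMap e} (ER.weakenᴾ≐σ n ∘ e) (fold ηᴮ u) ⟩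
      fun (σ R (σ R ηweaken ∘ₘ ΔMap e)) (fold ηᴮ u)
        ≡⟨ σ-σ R (ΔMap e) ηweaken (fold ηᴮ u) ⟨
      fun (σ R ηweaken) (fun (σ R (ΔMap e)) (fold ηᴮ u))
        ≡⟨ ER.weakenᴾ≐σ n _ ⟨
      fun (ER.weakenᴾ n) (fun (σ R (ΔMap e)) (fold ηᴮ u))
        ≡⟨ cong (fun (ER.weakenᴾ n)) (fold-σ e u) ⟨
      fun (ER.weakenᴾ n) (fold e u) ∎
      where open ≡-Reasoning
            ηweaken = η R ∘ₘ Δm (weaken n)

    mutual
      fold-sub : ∀ (e : W → Carrier (P R Y)) (f : X → Term S W) → fold e ∘ sub f ≗ fold (fold e ∘ f)
      fold-sub e f (var x) = refl
      fold-sub {Y = Y} e f (app o ts) = cong (fun (ρ (op B o) Y)) (foldArgs-subArgs e f (ar S o) ts)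

      foldArgs-subArgs : ∀ (e : W → Carrier (P R Y)) (f : X → Term S W) s →
                         foldArgs e s ∘ subArgs f ≗ foldArgs (fold e ∘ f) s
      foldArgs-subArgs e f [] [] = refl
      foldArgs-subArgs e f (n ∷ []) (t ∷ []) = cong (ER.fromDeriv n) (fold-extend-sub n e f t)
      foldArgs-subArgs e f (n ∷ m ∷ s) (t ∷ ts) =
        cong₂ _,_ (cong (ER.fromDeriv n) (fold-extend-sub n e f t)) (foldArgs-subArgs e f (m ∷ s) ts)

      fold-extend-sub : ∀ n (e : W → Carrier (P R Y)) (f : X → Term S W) →
                        fold (extend n e) ∘ sub (exts f) ≗ fold (extend n (fold e ∘ f))
      fold-extend-sub n e f t = trans (fold-sub (extend n e) (exts f) t) (fold-cong extend-exts t)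
        where
        extend-exts : fold (extend n e) ∘ exts f ≗ extend n (fold e ∘ f)
        extend-exts (inj₁ x) = trans (fold-ren (extend n e) inj₁ (f x)) (fold-weakenᴾ n e (f x))
        extend-exts (inj₂ i) = refl

    foldMonadMor : MonadMor termMonad R
    foldMonadMor = record
      { τ = λ c → ΔMap (fold ηᴮ)
      ; τ-σ = λ f t → trans (fold-sub ηᴮ (fun f) t)
                     (trans (fold-σ (fold ηᴮ ∘ fun f) t)
                            -- the two maps differ only in their monotonicity proofs
                            (σ-cong R {g = ΔMap (fold ηᴮ) ∘ₘ f} (λ _ → refl) (fold ηᴮ t)))
      ; τ-η = λ x → refl
      }

    extend-η : ∀ n → extend {X} {X} n ηᴮ ≗ ηᴮ ∘ fromSum n
    extend-η n (inj₁ x) = ER.weakenᴾ-η n x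
    extend-η n (inj₂ i) = refl

    fold-extend-η-toSum : ∀ n (u : Term S (Ext n X)) → fold (extend n ηᴮ) (ren (toSum n) u) ≡ fold ηᴮ u
    fold-extend-η-toSum n u =
      trans (fold-ren (extend n ηᴮ) (toSum n) u)
            (fold-cong (λ z → trans (extend-η n (toSum n z)) (cong ηᴮ (fromSum-toSum n z))) u)

    liftD-foldMonadMor : ∀ n (x : Carrier (M (deriv termMonad n (taut termMonad)) V)) →
                         ER.fromDeriv n (fold (extend n ηᴮ) (ren (toSum n) (toDeriv n x)))
                         ≡ fun (liftD foldMonadMor n V) x
    liftD-foldMonadMor n x =
      trans (cong (ER.fromDeriv n) (fold-extend-η-toSum n (toDeriv n x))) (sym (liftD-toDeriv foldMonadMor n x))

    foldArgs-argsOf : ∀ s (x : Carrier (M (arMod termMonad s (taut termMonad)) V)) →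
                      foldArgs ηᴮ s (argsOf s x) ≡ fun (liftA foldMonadMor s V) x
    foldArgs-argsOf [] x = refl
    foldArgs-argsOf (n ∷ []) x = liftD-foldMonadMor n x
    foldArgs-argsOf (n ∷ m ∷ s) (x , y) = cong₂ _,_ (liftD-foldMonadMor n x) (foldArgs-argsOf (m ∷ s) y)

    foldRepMor : RepMor termRep B
    foldRepMor = record
      { mor = foldMonadMor
      ; commut = λ o V x → cong (fun (ρ (op B o) V)) (foldArgs-argsOf (ar S o) x)
      }

    module _ (g : RepMor termRep B) where

      private
        τg : ∀ Y → Term S Y → Carrier (P R Y)
        τg Y = fun (τ (mor g) Y)

      τg-ren-exts : ∀ n (r : X → Term S Y) →
                    τg (Ext n Y) ∘ ren (fromSum n) ∘ exts r ≗ extend n (τg Y ∘ r)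
      τg-ren-exts {Y = Y} n r (inj₁ x) = begin
        τg (Ext n Y) (ren (fromSum n) (ren inj₁ (r x))) ≡⟨ cong (τg (Ext n Y)) (ren-ren (λ _ → refl) (r x)) ⟩
        τg (Ext n Y) (ren (weaken n) (r x))             ≡⟨ cong (τg (Ext n Y)) (weakenᴾ≐ren n (r x)) ⟨
        τg (Ext n Y) (fun (weakenᴾ n) (r x))            ≡⟨ τ-weakenᴾ (mor g) n (r x) ⟩
        fun (ER.weakenᴾ n) (τg Y (r x))                 ∎
        where open ≡-Reasoning
      τg-ren-exts n r (inj₂ i) = τ-η (mor g) (fresh n i)

      mutual
        τ-sub : ∀ (r : X → Term S Y) t → τg Y (sub r t) ≡ fold (τg Y ∘ r) t
        τ-sub r (var x) = refl
        τ-sub {Y = Y} r (app o ts) = begin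
          τg Y (app o (subArgs r ts))
            ≡⟨ cong (τg Y ∘ app o) (argsOf-argsTuple (ar S o) (subArgs r ts)) ⟨
          τg Y (app o (argsOf (ar S o) (argsTuple (ar S o) (subArgs r ts))))
            ≡⟨ commut g o Y (argsTuple (ar S o) (subArgs r ts)) ⟩
          fun (ρ (op B o) Y) (fun (liftA (mor g) (ar S o) Y) (argsTuple (ar S o) (subArgs r ts)))
            ≡⟨ cong (fun (ρ (op B o) Y)) (liftA-argsTuple-subArgs r (ar S o) ts) ⟩
          fun (ρ (op B o) Y) (foldArgs (τg Y ∘ r) (ar S o) ts) ∎
          where open ≡-Reasoning

        liftA-argsTuple-subArgs : ∀ (r : X → Term S Y) s ts →
          fun (liftA (mor g) s Y) (argsTuple s (subArgs r ts)) ≡ foldArgs (τg Y ∘ r) s ts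
        liftA-argsTuple-subArgs r [] [] = refl
        liftA-argsTuple-subArgs r (n ∷ []) (t ∷ []) = liftD-fromDeriv-sub n r t
        liftA-argsTuple-subArgs r (n ∷ m ∷ s) (t ∷ ts) =
          cong₂ _,_ (liftD-fromDeriv-sub n r t) (liftA-argsTuple-subArgs r (m ∷ s) ts)

        liftD-fromDeriv-sub : ∀ n (r : X → Term S Y) (t : Term S (X ⊎ Fin n)) →
          fun (liftD (mor g) n Y) (fromDeriv n (ren (fromSum n) (sub (exts r) t)))
          ≡ ER.fromDeriv n (fold (extend n (τg Y ∘ r)) t)
        liftD-fromDeriv-sub {Y = Y} n r t = trans (liftD-toDeriv (mor g) n _) (cong (ER.fromDeriv n) (begin
          τg (Ext n Y) (toDeriv n (fromDeriv n (ren (fromSum n) (sub (exts r) t))))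
            ≡⟨ cong (τg (Ext n Y)) (toDeriv-fromDeriv n _) ⟩
          τg (Ext n Y) (ren (fromSum n) (sub (exts r) t))
            ≡⟨ cong (τg (Ext n Y)) (ren-sub (λ _ → refl) t) ⟩
          τg (Ext n Y) (sub (ren (fromSum n) ∘ exts r) t)
            ≡⟨ τ-sub (ren (fromSum n) ∘ exts r) t ⟩
          fold (τg (Ext n Y) ∘ ren (fromSum n) ∘ exts r) t
            ≡⟨ fold-cong (τg-ren-exts n r) t ⟩
          fold (extend n (τg Y ∘ r)) t ∎))
          where open ≡-Reasoning

      foldRepMor-unique : foldRepMor ≐ᵣ g
      foldRepMor-unique V t = sym (begin
        τg V t                ≡⟨ cong (τg V) (sub-var (λ _ → refl) t) ⟨
        τg V (sub var t)      ≡⟨ τ-sub var t ⟩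
        fold (τg V ∘ var) t   ≡⟨ fold-cong (τ-η (mor g)) t ⟩
        fold ηᴮ t             ∎)
        where open ≡-Reasoning

lemma2p12 : (S : Sig) →
    Σ (Rep S) (λ R → IsInitial R × ((V : Set) → P (monad R) V ≡ Δ (Term S V)))
lemma2p12 S = termRep , (λ B → foldRepMor B , foldRepMor-unique B) , λ V → refl
  where open Syntax S
        open Fold
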